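{- Every configuration matching template (B1) is reducible. Here a configuration $(C,X,\operatorname{ex})$ matches template (B1) if $C$ consists of a triangle $uvw$ with $u,v,w\in X$, $\operatorname{ex}(u)=\operatorname{ex}(w)=2$, $\operatorname{ex}(v)=0$, together with an extra-special $uv$-path $P_1$ and a special $vw$-path $P_2$.
   Context: A configuration is a triple $(C,X,\operatorname{ex})$ where $C$ is a plane graph, $X\subseteq V(C)$, and $\operatorname{ex}:V(C)\to\{0,1,2,\infty\}$ (external degree). Its list-size function is $f(v)=4-\operatorname{ex}(v)$ for $v\in X$ and $f(v)=1$ for $v\notin X$. An $(f,2)$-list-assignment of $C$ is a list assignment $L$ with $|L(v)|\ge f(v)$ for all $v$, $|L(u)\cap L(v)|\le 2$ for every edge $uv$, and $L(u)\cap L(v)=\emptyset$ for every edge $uv$ with $f(u)=f(v)=1$; the configuration is reducible if $C$ has a proper coloring from $L$ for every $(f,2)$-list-assignment $L$. For $u,v\in X$, a special $uv$-path is a $uv$-path in $C$ all of whose internal vertices lie in $X$, have degree $2$ in $C$ and external degree $2$. An extra-special $uv$-path is a $uv$-path in $C$ all of whose internal vertices lie in $X$ and have external degree $2$ and degree $2$ in $C$, except for one consecutive pair $x,y$ of internal vertices with $\operatorname{ex}(x)=\operatorname{ex}(y)=1$ and $d_C(x)=d_C(y)=3$, where there is a vertex $z\notin X$ of $C$ adjacent to both $x$ and $y$ and to no other vertex of $C$. -}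

module Defs where

open import Data.Nat using (ℕ; _≤_; _∸_)
open import Data.Nat.Properties using (_≟_)
open import Data.Fin using (Fin)
open import Data.Bool using (Bool; true; false) renaming (_≟_ to _B≟_)
open import Data.List using (List; []; _∷_; _++_; length; filter; allFin)
open import Data.List.Relation.Unary.All using (All)
open import Data.List.Relation.Unary.Unique.Propositional using (Unique)
open import Data.List.Relation.Unary.Linked using (Linked)
open import Data.List.Membership.Propositional using (_∈_)
open import Data.List.Membership.DecPropositional _≟_ using (_∈?_)
open import Data.Product using (Σ; ∃; ∃-syntax; _×_; _,_)
open import Data.Sum using (_⊎_)
open import Relation.Binary.PropositionalEquality using (_≡_; _≢_)

record Graph : Set where
  field
    n     : ℕ
    adj   : Fin n → Fin n → Bool
    sym   : ∀ a b → adj a b ≡ adj b a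
    irrefl : ∀ a → adj a a ≡ false

open Graph public

V : Graph → Set
V C = Fin (n C)

Adj : (C : Graph) → V C → V C → Set
Adj C a b = adj C a b ≡ true

deg : (C : Graph) → V C → ℕ
deg C a = length (filter (λ b → adj C a b B≟ true) (allFin (n C)))

data Ex : Set where
  e0 e1 e2 e∞ : Ex

-- 4 - ex, truncated at 0 (so 4 - ∞ = 0)
fourMinus : Ex → ℕ
fourMinus e0 = 4
fourMinus e1 = 3
fourMinus e2 = 2
fourMinus e∞ = 0

record Configuration : Set where
  field
    C  : Graph
    X  : V C → Bool
    ex : V C → Ex

open Configuration public

InX : (K : Configuration) → V (C K) → Set
InX K a = X K a ≡ true

f : (K : Configuration) → V (C K) → ℕ
f K a with X K a
... | true  = fourMinus (ex K a)
... | false = 1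

-- (f,2)-list-assignments.  Lists are duplicate-free lists of colours (ℕ),
-- i.e. finite sets of colours.

inter : List ℕ → List ℕ → List ℕ
inter A B = filter (_∈? B) A

record IsF2ListAssignment (K : Configuration) (L : V (C K) → List ℕ) : Set where
  field
    unique   : ∀ a → Unique (L a)
    size     : ∀ a → f K a ≤ length (L a)
    smallOverlap : ∀ a b → Adj (C K) a b → length (inter (L a) (L b)) ≤ 2
    disjoint : ∀ a b → Adj (C K) a b → f K a ≡ 1 → f K b ≡ 1 →
               inter (L a) (L b) ≡ []

IsLColouring : (K : Configuration) → (V (C K) → List ℕ) → (V (C K) → ℕ) → Set
IsLColouring K L c = (∀ a → c a ∈ L a) × (∀ a b → Adj (C K) a b → c a ≢ c b)

Reducible : Configuration → Set
Reducible K = ∀ (L : V (C K) → List ℕ) → IsF2ListAssignment K L →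
              ∃[ c ] IsLColouring K L c

-- Paths.  A uv-path is given by its list of internal vertices `is`;
-- its full vertex sequence is  u ∷ is ++ v ∷ [] , which must consist of
-- distinct vertices with consecutive ones adjacent.

pathVerts : ∀ {A : Set} → A → List A → A → List A
pathVerts u is v = u ∷ is ++ v ∷ []

IsPath : (C : Graph) → V C → List (V C) → V C → Set
IsPath C u is v = Unique (pathVerts u is v) × Linked (Adj C) (pathVerts u is v)

-- internal vertex condition for special paths: in X, degree 2, ex 2
Plain : (K : Configuration) → V (C K) → Set
Plain K a = InX K a × deg (C K) a ≡ 2 × ex K a ≡ e2

IsSpecialPath : (K : Configuration) → V (C K) → List (V (C K)) → V (C K) → Set
IsSpecialPath K u is v = InX K u × InX K v × IsPath (C K) u is v × All (Plain K) is

record IsExtraSpecialPath (K : Configuration) (u : V (C K))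
         (as : List (V (C K))) (x y : V (C K)) (bs : List (V (C K)))
         (z : V (C K)) (v : V (C K)) : Set where
  field
    uX    : InX K u
    vX    : InX K v
    path  : IsPath (C K) u (as ++ x ∷ y ∷ bs) v
    asP   : All (Plain K) as
    bsP   : All (Plain K) bs
    xX    : InX K x
    yX    : InX K y
    exx   : ex K x ≡ e1
    exy   : ex K y ≡ e1
    degx  : deg (C K) x ≡ 3
    degy  : deg (C K) y ≡ 3
    zX    : X K z ≡ false
    zx    : Adj (C K) z x
    zy    : Adj (C K) z y
    zonly : ∀ t → Adj (C K) z t → t ≡ x ⊎ t ≡ y

ConsecIn : ∀ {A : Set} → A → A → List A → Set
ConsecIn {A} s t vs =
  ∃[ pre ] ∃[ post ] (vs ≡ pre ++ s ∷ t ∷ post ⊎ vs ≡ pre ++ t ∷ s ∷ post)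

-- Template (B1): C consists of a triangle uvw (u,v,w ∈ X,
-- ex u = ex w = 2, ex v = 0) together with an extra-special uv-path P1
-- (internal vertices as ++ x ∷ y ∷ bs, attached vertex z) and a special
-- vw-path P2 (internal vertices cs).  "Consists of" = every vertex and
-- every edge of C belongs to the triangle, P1 (incl. z, zx, zy) or P2.

record B1Data (K : Configuration) : Set where
  field
    u v w : V (C K)
    as bs cs : List (V (C K))
    x y z : V (C K)
    uX : InX K u
    vX : InX K v
    wX : InX K w
    exu : ex K u ≡ e2
    exv : ex K v ≡ e0
    exw : ex K w ≡ e2
    uv : Adj (C K) u v
    vw : Adj (C K) v w
    uw : Adj (C K) u w
    P1 : IsExtraSpecialPath K u as x y bs z v
    P2 : IsSpecialPath K v cs w
    verts : ∀ t → t ≡ u ⊎ t ≡ v ⊎ t ≡ w ⊎ t ≡ z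
                  ⊎ t ∈ (as ++ x ∷ y ∷ bs) ⊎ t ∈ cs
    edges : ∀ s t → Adj (C K) s t →
              ConsecIn s t (u ∷ v ∷ w ∷ u ∷ [])
            ⊎ ConsecIn s t (pathVerts u (as ++ x ∷ y ∷ bs) v)
            ⊎ ConsecIn s t (z ∷ x ∷ []) ⊎ ConsecIn s t (z ∷ y ∷ [])
            ⊎ ConsecIn s t (pathVerts v cs w)

MatchesB1 : Configuration → Set
MatchesB1 K = B1Data K

-- Colour greedily: z, then x, then u and the vertices of as walking back from x, then w,
-- the vertices of cs walking back from w, then v, the vertices of bs walking back from v,
-- and y last. A path vertex has two colours and only its already coloured successor to
-- avoid, v has four colours against its three coloured neighbours, and y, with three
-- colours, must avoid z, x and its bs-neighbour, of which at most two lie in L y because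
-- x was chosen outside L y whenever z's colour lies in L y. To glue these choices into one
-- colouring, the degree conditions show that P₁ and P₂ meet only in v.

module Submission where

open import Defs
open import Data.Nat using (ℕ; suc; _≤_; _<_; z≤n; s≤s)
open import Data.Nat.Properties using (_≟_; <-irrefl; ≤⇒≯; <-≤-trans; module ≤-Reasoning)
open import Data.Fin using (Fin) renaming (_≟_ to _≟ᶠ_)
open import Data.Bool using (true; false) renaming (_≟_ to _≟ᵇ_)
open import Data.List using (List; []; _∷_; _++_; length; filter; map; allFin)
open import Data.List.Relation.Unary.All as All using (All; []; _∷_)
open import Data.List.Relation.Unary.All.Properties as All using ()
open import Data.List.Relation.Unary.Any using (here; there)
open import Data.List.Relation.Unary.Unique.Propositional
  using (Unique; []; _∷_) renaming (tail to Unique-tail)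
open import Data.List.Relation.Unary.Unique.Propositional.Properties as Unique using ()
open import Data.List.Relation.Unary.Linked as Linked using (Linked; []; [-]; _∷_)
open import Data.List.Relation.Binary.Subset.Propositional using (_⊆_)
open import Data.List.Relation.Binary.Disjoint.Propositional using (Disjoint)
open import Data.List.Membership.Propositional using (_∈_; _∉_)
open import Data.List.Membership.Propositional.Properties
  using (∈-++⁺ˡ; ∈-++⁺ʳ; ∈-++⁻; ∈-∃++; ∈-filter⁺; ∈-allFin; ∈-map⁺)
open import Data.List.Properties using (map-++; ++-assoc; filter-all; length-++-sucʳ)
open import Data.Product using (∃₂; ∃-syntax; _×_; _,_; proj₁; proj₂)
open import Data.Sum using (_⊎_; inj₁; inj₂)
open import Function using (_∘_; id)
open import Relation.Nullary using (¬_; yes; no; contradiction)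
open import Relation.Binary.Definitions using (Symmetric; DecidableEquality)
open import Relation.Binary.PropositionalEquality
  using (_≡_; _≢_; refl; cong; cong₂; subst; ≢-sym; module ≡-Reasoning)
  renaming (sym to ≡-sym; trans to ≡-trans)

module _ {A : Set} where

  Unique-∷⇒≢ : ∀ {a b : A} {xs} → Unique (a ∷ xs) → b ∈ xs → a ≢ b
  Unique-∷⇒≢ (a≢ ∷ _) b∈xs = All.lookup a≢ b∈xs

  Unique-++⁻ˡ : ∀ (xs : List A) {ys} → Unique (xs ++ ys) → Unique xs
  Unique-++⁻ˡ []       _         = []
  Unique-++⁻ˡ (x ∷ xs) (x≢ ∷ u) = All.++⁻ˡ xs x≢ ∷ Unique-++⁻ˡ xs u

  Unique-++⇒Disjoint : ∀ (xs : List A) {ys} → Unique (xs ++ ys) → Disjoint xs ys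
  Unique-++⇒Disjoint (x ∷ xs) (x≢ ∷ _) (here refl , a∈ys) = All.lookup x≢ (∈-++⁺ʳ xs a∈ys) refl
  Unique-++⇒Disjoint (x ∷ xs) (_ ∷ u) (there a∈xs , a∈ys) = Unique-++⇒Disjoint xs u (a∈xs , a∈ys)

  unique-⊆⇒length≤ : ∀ {xs ys : List A} → Unique xs → xs ⊆ ys → length xs ≤ length ys
  unique-⊆⇒length≤ [] _ = z≤n
  unique-⊆⇒length≤ {x ∷ xs} (x∉xs ∷ u) xs⊆ys with ∈-∃++ (xs⊆ys (here refl))
  ... | pre , post , refl = begin
        suc (length xs)            ≤⟨ s≤s (unique-⊆⇒length≤ u xs⊆pre++post) ⟩
        suc (length (pre ++ post)) ≡⟨ ≡-sym (length-++-sucʳ pre x post) ⟩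
        length (pre ++ x ∷ post)   ∎
    where
    open ≤-Reasoning
    xs⊆pre++post : xs ⊆ pre ++ post
    xs⊆pre++post t∈xs with ∈-++⁻ pre (xs⊆ys (there t∈xs))
    ... | inj₁ t∈pre          = ∈-++⁺ˡ t∈pre
    ... | inj₂ (here refl)    = contradiction refl (All.lookup x∉xs t∈xs)
    ... | inj₂ (there t∈post) = ∈-++⁺ʳ pre t∈post

module _ {A : Set} (_≟ᴬ_ : DecidableEquality A) where
  open import Data.List.Membership.DecPropositional _≟ᴬ_ using (_∈?_)

  ⊆⊎∃∉ : ∀ (xs ys : List A) → xs ⊆ ys ⊎ ∃[ a ] (a ∈ xs × a ∉ ys)
  ⊆⊎∃∉ [] ys = inj₁ λ ()
  ⊆⊎∃∉ (x ∷ xs) ys with x ∈? ys | ⊆⊎∃∉ xs ys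
  ... | no x∉ys  | _                       = inj₂ (x , here refl , x∉ys)
  ... | yes x∈ys | inj₁ xs⊆ys              = inj₁ λ { (here refl) → x∈ys ; (there a∈xs) → xs⊆ys a∈xs }
  ... | yes _    | inj₂ (a , a∈xs , a∉ys) = inj₂ (a , there a∈xs , a∉ys)

  length<⇒∃∉ : ∀ (xs ys : List A) → Unique xs → length ys < length xs → ∃[ a ] (a ∈ xs × a ∉ ys)
  length<⇒∃∉ xs ys u ys<xs with ⊆⊎∃∉ xs ys
  ... | inj₁ xs⊆ys = contradiction ys<xs (≤⇒≯ (unique-⊆⇒length≤ u xs⊆ys))
  ... | inj₂ a∉    = a∉

  filter∈<⇒∃∉ : ∀ (xs ys : List A) → length (filter (_∈? ys) xs) < length xs → ∃[ a ] (a ∈ xs × a ∉ ys)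
  filter∈<⇒∃∉ xs ys overlap<xs with ⊆⊎∃∉ xs ys
  ... | inj₁ xs⊆ys =
        contradiction overlap<xs (<-irrefl (cong length (filter-all (_∈? ys) (All.tabulate xs⊆ys))))
  ... | inj₂ a∉    = a∉

  avoid-or-escape : ∀ {a} (xs ys : List A) → Unique xs → 3 ≤ length xs →
                    length (filter (_∈? ys) xs) ≤ 2 →
                    ∃[ e ] (e ∈ xs × e ≢ a × (a ∈ ys → e ∉ ys))
  avoid-or-escape {a} xs ys u 3≤ overlap≤2 with a ∈? ys
  ... | yes a∈ys with filter∈<⇒∃∉ xs ys (<-≤-trans (s≤s overlap≤2) 3≤)
  ...   | e , e∈ , e∉ = e , e∈ , (λ { refl → e∉ a∈ys }) , λ _ → e∉
  avoid-or-escape {a} xs ys u 3≤ _ | no a∉ys with length<⇒∃∉ xs (a ∷ []) u (<-≤-trans (s≤s (s≤s z≤n)) 3≤)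
  ...   | e , e∈ , e∉ = e , e∈ , e∉ ∘ here , λ a∈ys → contradiction a∈ys a∉ys

  avoid-three : ∀ {a b c} (xs : List A) → Unique xs → 3 ≤ length xs → (a ∈ xs → b ∉ xs) →
                ∃[ e ] (e ∈ xs × e ≢ a × e ≢ b × e ≢ c)
  avoid-three {a} {b} {c} xs u 3≤ a∈⇒b∉ with a ∈? xs
  ... | yes a∈ with length<⇒∃∉ xs (a ∷ c ∷ []) u 3≤
  ...   | e , e∈ , e∉ = e , e∈ , e∉ ∘ here , (λ { refl → a∈⇒b∉ a∈ e∈ }) , e∉ ∘ there ∘ here
  avoid-three {a} {b} {c} xs u 3≤ _ | no a∉ with length<⇒∃∉ xs (b ∷ c ∷ []) u 3≤
  ...   | e , e∈ , e∉ = e , e∈ , (λ { refl → a∉ e∈ }) , e∉ ∘ here , e∉ ∘ there ∘ here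

module _ {A : Set} {R : A → A → Set} where

  Linked-++⁻ʳ : ∀ (xs : List A) {ys} → Linked R (xs ++ ys) → Linked R ys
  Linked-++⁻ʳ []       l = l
  Linked-++⁻ʳ (x ∷ xs) l = Linked-++⁻ʳ xs (Linked.tail l)

  Linked-++⁺-shared : ∀ (xs : List A) {a ys} → Linked R (xs ++ a ∷ []) → Linked R (a ∷ ys) →
                      Linked R (xs ++ a ∷ ys)
  Linked-++⁺-shared []           _        l = l
  Linked-++⁺-shared (x ∷ [])     (r ∷ _)  l = r ∷ l
  Linked-++⁺-shared (x ∷ y ∷ xs) (r ∷ l′) l = r ∷ Linked-++⁺-shared (y ∷ xs) l′ l

  Linked-next : ∀ {h e t} (xs : List A) {ys} → Linked R (h ∷ xs ++ e ∷ ys) → t ∈ h ∷ xs →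
                ∃[ q ] (q ∈ xs ++ e ∷ [] × R t q)
  Linked-next []       (r ∷ _) (here refl) = _ , here refl , r
  Linked-next (x ∷ xs) (r ∷ _) (here refl) = x , here refl , r
  Linked-next (x ∷ xs) (_ ∷ l) (there t∈) with Linked-next xs l t∈
  ... | q , q∈ , tq = q , there q∈ , tq

  Linked-prev : ∀ {h e t} (xs : List A) {ys} → Linked R (h ∷ xs ++ e ∷ ys) → t ∈ xs ++ e ∷ [] →
                ∃[ p ] (p ∈ h ∷ xs × R p t)
  Linked-prev []       (r ∷ _) (here refl) = _ , here refl , r
  Linked-prev (x ∷ xs) (r ∷ _) (here refl) = _ , here refl , r
  Linked-prev (x ∷ xs) (_ ∷ l) (there t∈) with Linked-prev xs l t∈
  ... | p , p∈ , pt = p , there p∈ , pt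

  interior-neighbours : ∀ {a b t} (is : List A) →
                        Unique (pathVerts a is b) → Linked R (pathVerts a is b) → t ∈ is →
                        ∃₂ λ p q → p ∈ pathVerts a is b × q ∈ pathVerts a is b × p ≢ q × R p t × R t q
  interior-neighbours (i ∷ is) u (r ∷ l) (here refl) with Linked-next is l (here refl)
  ... | q , q∈ , tq = _ , q , here refl , there (there q∈) , Unique-∷⇒≢ u (there q∈) , r , tq
  interior-neighbours (i ∷ is) (_ ∷ u) (_ ∷ l) (there t∈) with interior-neighbours is u l t∈
  ... | p , q , p∈ , q∈ , p≢q , pt , tq = p , q , there p∈ , there q∈ , p≢q , pt , tq

  ConsecIn⇒R : Symmetric R → ∀ {s t xs} → Linked R xs → ConsecIn s t xs → R s t
  ConsecIn⇒R _   l (pre , _ , inj₁ refl) = Linked.head (Linked-++⁻ʳ pre l)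
  ConsecIn⇒R sym l (pre , _ , inj₂ refl) = sym (Linked.head (Linked-++⁻ʳ pre l))

module _ (G : Graph) where

  Adj-sym : ∀ {a b} → Adj G a b → Adj G b a
  Adj-sym {a} {b} ab = ≡-trans (Graph.sym G b a) ab

  Adj-irrefl : ∀ {a b} → Adj G a b → a ≢ b
  Adj-irrefl {a} aa refl with ≡-trans (≡-sym aa) (irrefl G a)
  ... | ()

  deg≡2⇒¬¬P-neighbour : ∀ {P : V G → Set} {t p q r} → deg G t ≡ 2 →
                        Adj G t p → Adj G t q → p ≢ q → P p → P q → Adj G t r → ¬ ¬ P r
  deg≡2⇒¬¬P-neighbour {t = t} {p} {q} {r} deg≡2 tp tq p≢q Pp Pq tr ¬Pr
    with subst (3 ≤_) deg≡2 (unique-⊆⇒length≤ distinct neighbours)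
    where
    distinct : Unique (p ∷ q ∷ r ∷ [])
    distinct = (p≢q ∷ (λ { refl → ¬Pr Pp }) ∷ []) ∷ ((λ { refl → ¬Pr Pq }) ∷ []) ∷ [] ∷ []
    neighbour : ∀ {b} → Adj G t b → b ∈ filter (λ b → adj G t b ≟ᵇ true) (allFin (n G))
    neighbour {b} tb = ∈-filter⁺ (λ b → adj G t b ≟ᵇ true) (∈-allFin b) tb
    neighbours : p ∷ q ∷ r ∷ [] ⊆ filter (λ b → adj G t b ≟ᵇ true) (allFin (n G))
    neighbours (here refl)                 = neighbour tp
    neighbours (there (here refl))         = neighbour tq
    neighbours (there (there (here refl))) = neighbour tr
  ... | s≤s (s≤s ())

module _ (K : Configuration) where

  f-inX : ∀ {a} → InX K a → f K a ≡ fourMinus (ex K a)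
  f-inX a∈X rewrite a∈X = refl

  f-outX : ∀ {a} → X K a ≡ false → f K a ≡ 1
  f-outX a∉X rewrite a∉X = refl

  Plain-deg : ∀ {a} → Plain K a → deg (C K) a ≡ 2
  Plain-deg = proj₁ ∘ proj₂

module _ {m : ℕ} where

  colourOf : List (Fin m × ℕ) → Fin m → ℕ
  colourOf []             _ = 0
  colourOf ((s , k) ∷ ps) t with t ≟ᶠ s
  ... | yes _ = k
  ... | no  _ = colourOf ps t

  colourOf-∈ : ∀ ps {t k} → Unique (map proj₁ ps) → (t , k) ∈ ps → colourOf ps t ≡ k
  colourOf-∈ ((s , j) ∷ ps) {t} _ (here refl) with t ≟ᶠ s
  ... | yes _   = refl
  ... | no  t≢t = contradiction refl t≢t
  colourOf-∈ ((s , j) ∷ ps) {t} (s∉ ∷ u) (there tk∈) with t ≟ᶠ s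
  ... | yes refl = contradiction refl (All.lookup s∉ (∈-map⁺ proj₁ tk∈))
  ... | no  _    = colourOf-∈ ps u tk∈

  colourOf-key : ∀ ps {t} → t ∈ map proj₁ ps → (t , colourOf ps t) ∈ ps
  colourOf-key ((s , j) ∷ ps) {t} t∈ with t ≟ᶠ s | t∈
  ... | yes refl | _         = here refl
  ... | no  t≢s  | here t≡s  = contradiction t≡s t≢s
  ... | no  _    | there t∈′ = there (colourOf-key ps t∈′)

  Linked-colourOf : ∀ ps → Unique (map proj₁ ps) → ∀ {qs} → qs ⊆ ps → Linked _≢_ (map proj₂ qs) →
                    Linked (λ s t → colourOf ps s ≢ colourOf ps t) (map proj₁ qs)
  Linked-colourOf ps u {[]}     _ _ = []
  Linked-colourOf ps u {_ ∷ []} _ _ = [-]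
  Linked-colourOf ps u {(s , j) ∷ (t , k) ∷ qs} qs⊆ps (j≢k ∷ l) =
    (λ eq → j≢k (≡-trans (≡-sym (colourOf-∈ ps u (qs⊆ps (here refl))))
                         (≡-trans eq (colourOf-∈ ps u (qs⊆ps (there (here refl)))))))
    ∷ Linked-colourOf ps u (qs⊆ps ∘ there) l

  leadColour : ℕ → List (Fin m × ℕ) → ℕ
  leadColour d []            = d
  leadColour _ ((_ , k) ∷ _) = k

  leadColour-∈ : ∀ {d t ts} ps → map proj₁ ps ≡ t ∷ ts → (t , leadColour d ps) ∈ ps
  leadColour-∈ (_ ∷ _) refl = here refl

  Linked-∷-leadColour : ∀ {d k} ps → k ≢ leadColour d ps → Linked _≢_ (map proj₂ ps ++ d ∷ []) →
                        Linked _≢_ (k ∷ map proj₂ ps ++ d ∷ [])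
  Linked-∷-leadColour []      k≢ l = k≢ ∷ l
  Linked-∷-leadColour (_ ∷ _) k≢ l = k≢ ∷ l

module PathColouring {m : ℕ} (L : Fin m → List ℕ) (L-unique : ∀ t → Unique (L t)) where

  InList : Fin m × ℕ → Set
  InList (t , k) = k ∈ L t

  record Colouring (ts : List (Fin m)) (d : ℕ) : Set where
    field
      pairs   : List (Fin m × ℕ)
      keys    : map proj₁ pairs ≡ ts
      inLists : All InList pairs
      proper  : Linked _≢_ (map proj₂ pairs ++ d ∷ [])

  avoid₁ : ∀ t d → 2 ≤ length (L t) → ∃[ k ] (k ∈ L t × k ≢ d)
  avoid₁ t d 2≤ with length<⇒∃∉ _≟_ (L t) (d ∷ []) (L-unique t) 2≤
  ... | k , k∈ , k∉ = k , k∈ , k∉ ∘ here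

  colourPath : ∀ ts d → All (λ t → 2 ≤ length (L t)) ts → Colouring ts d
  colourPath []       d []         = record { pairs = [] ; keys = refl ; inLists = [] ; proper = [-] }
  colourPath (t ∷ ts) d (2≤ ∷ 2≤s) with colourPath ts d 2≤s
  ... | record { pairs = ps ; keys = refl ; inLists = ps∈ ; proper = ps-proper }
    with avoid₁ t (leadColour d ps) 2≤
  ... | k , k∈ , k≢ = record
    { pairs   = (t , k) ∷ ps
    ; keys    = refl
    ; inLists = k∈ ∷ ps∈
    ; proper  = Linked-∷-leadColour ps k≢ ps-proper
    }

module B1Shape {K : Configuration} (D : B1Data K) where
  open B1Data D public
  open IsExtraSpecialPath P1 public using (path; asP; bsP; xX; yX; exx; exy; zX)

  G : Graph
  G = C K

  I₁ : List (V G)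
  I₁ = as ++ x ∷ y ∷ bs

  P₁ P₂ vertices : List (V G)
  P₁ = pathVerts u I₁ v
  P₂ = pathVerts v cs w
  vertices = z ∷ w ∷ P₁ ++ cs

  P₁-unique : Unique P₁
  P₁-unique = proj₁ path

  P₁-linked : Linked (Adj G) P₁
  P₁-linked = proj₂ path

  P₂-unique : Unique P₂
  P₂-unique = proj₁ (proj₁ (proj₂ (proj₂ P2)))

  P₂-linked : Linked (Adj G) P₂
  P₂-linked = proj₂ (proj₁ (proj₂ (proj₂ P2)))

  cs-plain : All (Plain K) cs
  cs-plain = proj₂ (proj₂ (proj₂ P2))

  P₁-linked-flat : Linked (Adj G) (u ∷ as ++ x ∷ y ∷ bs ++ v ∷ [])
  P₁-linked-flat = subst (λ is → Linked (Adj G) (u ∷ is)) (++-assoc as (x ∷ y ∷ bs) (v ∷ [])) P₁-linked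

  u∉I₁ : u ∉ I₁
  u∉I₁ u∈ = Unique-∷⇒≢ P₁-unique (∈-++⁺ˡ u∈) refl

  v∉I₁ : v ∉ I₁
  v∉I₁ v∈ = Unique-++⇒Disjoint I₁ (Unique-tail P₁-unique) (v∈ , here refl)

  u≢v : u ≢ v
  u≢v = Unique-∷⇒≢ P₁-unique (∈-++⁺ʳ I₁ (here refl))

  as+x⊆I₁ : as ++ x ∷ [] ⊆ I₁
  as+x⊆I₁ t∈ with ∈-++⁻ as t∈
  ... | inj₁ t∈as       = ∈-++⁺ˡ t∈as
  ... | inj₂ (here refl) = ∈-++⁺ʳ as (here refl)

  no-neighbour-in-I₁ : ∀ {t p q r} → deg G t ≡ 2 → Adj G t p → Adj G t q → p ≢ q →
                       p ∉ I₁ → q ∉ I₁ → Adj G t r → r ∉ I₁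
  no-neighbour-in-I₁ deg≡2 tp tq p≢q p∉ q∉ tr r∈ =
    deg≡2⇒¬¬P-neighbour G {P = _∉ I₁} deg≡2 tp tq p≢q p∉ q∉ tr (λ r∉ → r∉ r∈)

  w-neighbour∉I₁ : deg G w ≡ 2 → ∀ {r} → Adj G w r → r ∉ I₁
  w-neighbour∉I₁ deg≡2 = no-neighbour-in-I₁ deg≡2 (Adj-sym G uw) (Adj-sym G vw) u≢v u∉I₁ v∉I₁

  w∉I₁ : w ∉ I₁
  w∉I₁ w∈ with ∈-++⁻ as w∈
  ... | inj₁ w∈as with Linked-next as P₁-linked-flat (there w∈as)
  ...   | r , r∈ , wr =
          w-neighbour∉I₁ (Plain-deg K (All.lookup asP w∈as)) wr (as+x⊆I₁ r∈)
  w∉I₁ w∈ | inj₂ (here refl) with ≡-trans (≡-sym exw) exx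
  ... | ()
  w∉I₁ w∈ | inj₂ (there (here refl)) with ≡-trans (≡-sym exw) exy
  ... | ()
  w∉I₁ w∈ | inj₂ (there (there w∈bs))
    with Linked-prev bs (Linked.tail (Linked-++⁻ʳ (u ∷ as) P₁-linked-flat)) (∈-++⁺ˡ w∈bs)
  ... | r , r∈ , rw =
        w-neighbour∉I₁ (Plain-deg K (All.lookup bsP w∈bs)) (Adj-sym G rw) (∈-++⁺ʳ as (there r∈))

  w∉P₁ : w ∉ P₁
  w∉P₁ (here refl) = Adj-irrefl G uw refl
  w∉P₁ (there w∈) with ∈-++⁻ I₁ w∈
  ... | inj₁ w∈I₁        = w∉I₁ w∈I₁
  ... | inj₂ (here refl) = Adj-irrefl G vw refl

  v∉cs : v ∉ cs
  v∉cs v∈ = Unique-∷⇒≢ P₂-unique (∈-++⁺ˡ v∈) refl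

  w∉cs : w ∉ cs
  w∉cs w∈ = Unique-++⇒Disjoint cs (Unique-tail P₂-unique) (w∈ , here refl)

  u∉cs : u ∉ cs
  u∉cs u∈ with Linked-next as P₁-linked-flat (here refl)
  ... | r , r∈ , ur =
        no-neighbour-in-I₁ (Plain-deg K (All.lookup cs-plain u∈)) uv uw
                           (Adj-irrefl G vw) v∉I₁ w∉I₁ ur (as+x⊆I₁ r∈)

  -- Walking back along P₂ from w: a vertex of cs on P₁ would have its two P₁-neighbours
  -- and its P₂-successor, already known to be off P₁, as three distinct neighbours.
  P₂-suffix-avoids-P₁ : ∀ ds → ds ⊆ cs → Linked (Adj G) (ds ++ w ∷ []) → All (_∉ P₁) (ds ++ w ∷ [])
  P₂-suffix-avoids-P₁ []       _     _ = w∉P₁ ∷ []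
  P₂-suffix-avoids-P₁ (d ∷ ds) ds⊆cs l = d∉P₁ ∷ rest
    where
    rest : All (_∉ P₁) (ds ++ w ∷ [])
    rest = P₂-suffix-avoids-P₁ ds (ds⊆cs ∘ there) (Linked.tail l)
    d∈cs : d ∈ cs
    d∈cs = ds⊆cs (here refl)
    d∉P₁ : d ∉ P₁
    d∉P₁ (here refl) = u∉cs d∈cs
    d∉P₁ (there d∈) with ∈-++⁻ I₁ d∈
    ... | inj₂ (here refl) = v∉cs d∈cs
    ... | inj₁ d∈I₁
      with interior-neighbours I₁ P₁-unique P₁-linked d∈I₁ | Linked-next ds {ys = []} l (here refl)
    ... | p , q , p∈ , q∈ , p≢q , pd , dq | r , r∈ , dr =
          deg≡2⇒¬¬P-neighbour G (Plain-deg K (All.lookup cs-plain d∈cs)) (Adj-sym G pd) dq p≢q p∈ q∈ dr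
                              (All.lookup rest r∈)

  P₁-cs-disjoint : Disjoint P₁ cs
  P₁-cs-disjoint (t∈P₁ , t∈cs) =
    All.lookup (P₂-suffix-avoids-P₁ cs id (Linked.tail P₂-linked)) (∈-++⁺ˡ t∈cs) t∈P₁

  P₁-inX : ∀ {t} → t ∈ P₁ → InX K t
  P₁-inX (here refl) = uX
  P₁-inX (there t∈) with ∈-++⁻ I₁ t∈
  ... | inj₂ (here refl) = vX
  ... | inj₁ t∈I₁ with ∈-++⁻ as t∈I₁
  ...   | inj₁ t∈as                 = proj₁ (All.lookup asP t∈as)
  ...   | inj₂ (here refl)          = xX
  ...   | inj₂ (there (here refl))  = yX
  ...   | inj₂ (there (there t∈bs)) = proj₁ (All.lookup bsP t∈bs)

  vertices-unique : Unique vertices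
  vertices-unique = All.tabulate z≢ ∷ All.tabulate w≢ ∷ Unique.++⁺ P₁-unique cs-unique P₁-cs-disjoint
    where
    cs-unique : Unique cs
    cs-unique = Unique-++⁻ˡ cs (Unique-tail P₂-unique)
    inX : ∀ {t} → t ∈ w ∷ P₁ ++ cs → InX K t
    inX (here refl) = wX
    inX (there t∈) with ∈-++⁻ P₁ t∈
    ... | inj₁ t∈P₁ = P₁-inX t∈P₁
    ... | inj₂ t∈cs = proj₁ (All.lookup cs-plain t∈cs)
    z≢ : ∀ {t} → t ∈ w ∷ P₁ ++ cs → z ≢ t
    z≢ t∈ refl with ≡-trans (≡-sym zX) (inX t∈)
    ... | ()
    w≢ : ∀ {t} → t ∈ P₁ ++ cs → w ≢ t
    w≢ t∈ refl with ∈-++⁻ P₁ t∈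
    ... | inj₁ w∈P₁ = w∉P₁ w∈P₁
    ... | inj₂ w∈cs = w∉cs w∈cs

  vertices-complete : ∀ t → t ∈ vertices
  vertices-complete t with verts t
  ... | inj₁ refl                             = there (there (here refl))
  ... | inj₂ (inj₁ refl)                      = there (there (∈-++⁺ˡ (there (∈-++⁺ʳ I₁ (here refl)))))
  ... | inj₂ (inj₂ (inj₁ refl))               = there (here refl)
  ... | inj₂ (inj₂ (inj₂ (inj₁ refl)))        = here refl
  ... | inj₂ (inj₂ (inj₂ (inj₂ (inj₁ t∈I₁)))) = there (there (∈-++⁺ˡ (there (∈-++⁺ˡ t∈I₁))))
  ... | inj₂ (inj₂ (inj₂ (inj₂ (inj₂ t∈cs)))) = there (there (∈-++⁺ʳ P₁ t∈cs))

module B1Colouring {K : Configuration} (D : B1Data K) {L : V (C K) → List ℕ}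
                   (LA : IsF2ListAssignment K L) where
  open B1Shape D
  open IsF2ListAssignment LA
  open PathColouring L unique
  open Colouring

  list-size : ∀ {t e} → InX K t → ex K t ≡ e → fourMinus e ≤ length (L t)
  list-size {t} t∈X refl = subst (_≤ length (L t)) (f-inX K t∈X) (size t)

  plain-size : ∀ {t} → Plain K t → 2 ≤ length (L t)
  plain-size (t∈X , _ , ex≡2) = list-size t∈X ex≡2

  z-choice : ∃[ α ] α ∈ L z
  z-choice with length<⇒∃∉ _≟_ (L z) [] (unique z) (subst (_≤ length (L z)) (f-outX K zX) (size z))
  ... | α , α∈ , _ = α , α∈

  α : ℕ
  α = proj₁ z-choice

  α∈L : α ∈ L z
  α∈L = proj₂ z-choice

  x-choice : ∃[ ξ ] (ξ ∈ L x × ξ ≢ α × (α ∈ L y → ξ ∉ L y))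
  x-choice = avoid-or-escape _≟_ (L x) (L y) (unique x) (list-size xX exx)
                (smallOverlap x y (Linked.head (Linked-++⁻ʳ (u ∷ as) P₁-linked-flat)))

  ξ : ℕ
  ξ = proj₁ x-choice

  ξ∈L : ξ ∈ L x
  ξ∈L = proj₁ (proj₂ x-choice)

  ξ≢α : ξ ≢ α
  ξ≢α = proj₁ (proj₂ (proj₂ x-choice))

  R₁ : Colouring (u ∷ as) ξ
  R₁ = colourPath (u ∷ as) ξ (list-size uX exu ∷ All.map plain-size asP)

  μ : ℕ
  μ = leadColour ξ (pairs R₁)

  w-choice : ∃[ ω ] (ω ∈ L w × ω ≢ μ)
  w-choice = avoid₁ w μ (list-size wX exw)

  ω : ℕ
  ω = proj₁ w-choice

  ω∈L : ω ∈ L w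
  ω∈L = proj₁ (proj₂ w-choice)

  ω≢μ : ω ≢ μ
  ω≢μ = proj₂ (proj₂ w-choice)

  R₂ : Colouring cs ω
  R₂ = colourPath cs ω (All.map plain-size cs-plain)

  σ : ℕ
  σ = leadColour ω (pairs R₂)

  v-choice : ∃[ γ ] (γ ∈ L v × γ ∉ σ ∷ ω ∷ μ ∷ [])
  v-choice = length<⇒∃∉ _≟_ (L v) (σ ∷ ω ∷ μ ∷ []) (unique v) (list-size vX exv)

  γ : ℕ
  γ = proj₁ v-choice

  γ∈L : γ ∈ L v
  γ∈L = proj₁ (proj₂ v-choice)

  γ∉ : γ ∉ σ ∷ ω ∷ μ ∷ []
  γ∉ = proj₂ (proj₂ v-choice)

  R₃ : Colouring bs γ
  R₃ = colourPath bs γ (All.map plain-size bsP)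

  β : ℕ
  β = leadColour γ (pairs R₃)

  y-choice : ∃[ η ] (η ∈ L y × η ≢ α × η ≢ ξ × η ≢ β)
  y-choice = avoid-three _≟_ (L y) (unique y) (list-size yX exy) (proj₂ (proj₂ (proj₂ x-choice)))

  η : ℕ
  η = proj₁ y-choice

  η∈L : η ∈ L y
  η∈L = proj₁ (proj₂ y-choice)

  η≢α : η ≢ α
  η≢α = proj₁ (proj₂ (proj₂ y-choice))

  η≢ξ : η ≢ ξ
  η≢ξ = proj₁ (proj₂ (proj₂ (proj₂ y-choice)))

  η≢β : η ≢ β
  η≢β = proj₂ (proj₂ (proj₂ (proj₂ y-choice)))

  P₁-pairs P₂-pairs table : List (V G × ℕ)
  P₁-pairs = pairs R₁ ++ (x , ξ) ∷ (y , η) ∷ pairs R₃ ++ (v , γ) ∷ []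
  P₂-pairs = (v , γ) ∷ pairs R₂ ++ (w , ω) ∷ []
  table    = (z , α) ∷ (w , ω) ∷ P₁-pairs ++ pairs R₂

  col : V G → ℕ
  col = colourOf table

  P₁-keys : map proj₁ P₁-pairs ≡ P₁
  P₁-keys = begin
    map proj₁ (pairs R₁ ++ (x , ξ) ∷ (y , η) ∷ pairs R₃ ++ (v , γ) ∷ [])
      ≡⟨ map-++ proj₁ (pairs R₁) _ ⟩
    map proj₁ (pairs R₁) ++ x ∷ y ∷ map proj₁ (pairs R₃ ++ (v , γ) ∷ [])
      ≡⟨ cong (λ ts → map proj₁ (pairs R₁) ++ x ∷ y ∷ ts) (map-++ proj₁ (pairs R₃) _) ⟩
    map proj₁ (pairs R₁) ++ x ∷ y ∷ map proj₁ (pairs R₃) ++ v ∷ []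
      ≡⟨ cong₂ (λ ts ts′ → ts ++ x ∷ y ∷ ts′ ++ v ∷ []) (keys R₁) (keys R₃) ⟩
    u ∷ as ++ x ∷ y ∷ bs ++ v ∷ []
      ≡⟨ cong (u ∷_) (≡-sym (++-assoc as (x ∷ y ∷ bs) (v ∷ []))) ⟩
    P₁ ∎
    where open ≡-Reasoning

  P₂-keys : map proj₁ P₂-pairs ≡ P₂
  P₂-keys = cong (v ∷_) (≡-trans (map-++ proj₁ (pairs R₂) _) (cong (_++ w ∷ []) (keys R₂)))

  table-keys : map proj₁ table ≡ vertices
  table-keys = cong (λ ts → z ∷ w ∷ ts)
                    (≡-trans (map-++ proj₁ P₁-pairs (pairs R₂)) (cong₂ _++_ P₁-keys (keys R₂)))

  table-unique : Unique (map proj₁ table)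
  table-unique = subst Unique (≡-sym table-keys) vertices-unique

  table-inLists : All InList table
  table-inLists = α∈L ∷ ω∈L ∷ All.++⁺ P₁-inLists (inLists R₂)
    where
    P₁-inLists : All InList P₁-pairs
    P₁-inLists = All.++⁺ (inLists R₁) (ξ∈L ∷ η∈L ∷ All.++⁺ (inLists R₃) (γ∈L ∷ []))

  col∈L : ∀ t → col t ∈ L t
  col∈L t = All.lookup table-inLists
              (colourOf-key table (subst (t ∈_) (≡-sym table-keys) (vertices-complete t)))

  _≢ᶜ_ : V G → V G → Set
  s ≢ᶜ t = col s ≢ col t

  coloured : ∀ {ts} qs → qs ⊆ table → map proj₁ qs ≡ ts → Linked _≢_ (map proj₂ qs) → Linked _≢ᶜ_ ts
  coloured qs qs⊆ refl = Linked-colourOf table table-unique {qs} qs⊆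

  P₁⊆table : P₁-pairs ⊆ table
  P₁⊆table = there ∘ there ∘ ∈-++⁺ˡ

  uμ∈P₁ : (u , μ) ∈ P₁-pairs
  uμ∈P₁ = ∈-++⁺ˡ (leadColour-∈ (pairs R₁) (keys R₁))

  vγ∈P₁ : (v , γ) ∈ P₁-pairs
  vγ∈P₁ = ∈-++⁺ʳ (pairs R₁) (there (there (∈-++⁺ʳ (pairs R₃) (here refl))))

  P₁-proper : Linked _≢ᶜ_ P₁
  P₁-proper = coloured P₁-pairs P₁⊆table P₁-keys (subst (Linked _≢_) (≡-sym colours) linked)
    where
    colours : map proj₂ P₁-pairs ≡ map proj₂ (pairs R₁) ++ ξ ∷ η ∷ map proj₂ (pairs R₃) ++ γ ∷ []
    colours = ≡-trans (map-++ proj₂ (pairs R₁) _)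
                      (cong (λ ks → map proj₂ (pairs R₁) ++ ξ ∷ η ∷ ks) (map-++ proj₂ (pairs R₃) _))
    linked : Linked _≢_ (map proj₂ (pairs R₁) ++ ξ ∷ η ∷ map proj₂ (pairs R₃) ++ γ ∷ [])
    linked = Linked-++⁺-shared (map proj₂ (pairs R₁)) (proper R₁)
               (≢-sym η≢ξ ∷ Linked-∷-leadColour (pairs R₃) η≢β (proper R₃))

  P₂-proper : Linked _≢ᶜ_ P₂
  P₂-proper = coloured P₂-pairs P₂⊆table P₂-keys (subst (Linked _≢_) (≡-sym colours) linked)
    where
    P₂⊆table : P₂-pairs ⊆ table
    P₂⊆table (here refl) = P₁⊆table vγ∈P₁
    P₂⊆table (there p∈) with ∈-++⁻ (pairs R₂) p∈
    ... | inj₁ p∈R₂       = there (there (∈-++⁺ʳ P₁-pairs p∈R₂))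
    ... | inj₂ (here refl) = there (here refl)
    colours : map proj₂ P₂-pairs ≡ γ ∷ map proj₂ (pairs R₂) ++ ω ∷ []
    colours = cong (γ ∷_) (map-++ proj₂ (pairs R₂) _)
    linked : Linked _≢_ (γ ∷ map proj₂ (pairs R₂) ++ ω ∷ [])
    linked = Linked-∷-leadColour (pairs R₂) (γ∉ ∘ here) (proper R₂)

  triangle-proper : Linked _≢ᶜ_ (u ∷ v ∷ w ∷ u ∷ [])
  triangle-proper = coloured ((u , μ) ∷ (v , γ) ∷ (w , ω) ∷ (u , μ) ∷ []) ⊆table refl
    (≢-sym (γ∉ ∘ there ∘ there ∘ here) ∷ γ∉ ∘ there ∘ here ∷ ω≢μ ∷ [-])
    where
    ⊆table : (u , μ) ∷ (v , γ) ∷ (w , ω) ∷ (u , μ) ∷ [] ⊆ table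
    ⊆table (here refl)                         = P₁⊆table uμ∈P₁
    ⊆table (there (here refl))                 = P₁⊆table vγ∈P₁
    ⊆table (there (there (here refl)))         = there (here refl)
    ⊆table (there (there (there (here refl)))) = P₁⊆table uμ∈P₁

  zx-proper : Linked _≢ᶜ_ (z ∷ x ∷ [])
  zx-proper = coloured ((z , α) ∷ (x , ξ) ∷ []) ⊆table refl (≢-sym ξ≢α ∷ [-])
    where
    ⊆table : (z , α) ∷ (x , ξ) ∷ [] ⊆ table
    ⊆table (here refl)         = here refl
    ⊆table (there (here refl)) = P₁⊆table (∈-++⁺ʳ (pairs R₁) (here refl))

  zy-proper : Linked _≢ᶜ_ (z ∷ y ∷ [])
  zy-proper = coloured ((z , α) ∷ (y , η) ∷ []) ⊆table refl (≢-sym η≢α ∷ [-])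
    where
    ⊆table : (z , α) ∷ (y , η) ∷ [] ⊆ table
    ⊆table (here refl)         = here refl
    ⊆table (there (here refl)) = P₁⊆table (∈-++⁺ʳ (pairs R₁) (there (here refl)))

  col-proper : ∀ s t → Adj G s t → col s ≢ col t
  col-proper s t st with edges s t st
  ... | inj₁ c                      = ConsecIn⇒R ≢-sym triangle-proper c
  ... | inj₂ (inj₁ c)               = ConsecIn⇒R ≢-sym P₁-proper c
  ... | inj₂ (inj₂ (inj₁ c))        = ConsecIn⇒R ≢-sym zx-proper c
  ... | inj₂ (inj₂ (inj₂ (inj₁ c))) = ConsecIn⇒R ≢-sym zy-proper c
  ... | inj₂ (inj₂ (inj₂ (inj₂ c))) = ConsecIn⇒R ≢-sym P₂-proper c

lemma3p11 : (K : Configuration) → MatchesB1 K → Reducible K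
lemma3p11 K D L LA = col , col∈L , col-proper
  where open B1Colouring D LA
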